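{- Let $(A,\le,0,1)$ be a bounded MLUB-complete poset, $(T,R)$ a time frame with $R$ serial, and $P,F,H,G$ the tense operators induced by $(T,R)$. Then for every $B\in(\mathcal P_+A)^T$ and $s\in T$: $P(\varphi(B))(s)=\operatorname{Min}U(\bigcup\{B(t)\mid tRs\})$, $F(\varphi(B))(s)=\operatorname{Min}U(\bigcup\{B(t)\mid sRt\})$, $H(\varphi(B))(s)=\operatorname{Max}L(\bigcup\{B(t)\mid tRs\})$, $G(\varphi(B))(s)=\operatorname{Max}L(\bigcup\{B(t)\mid sRt\})$.
   Context: For a poset and $X\subseteq A$: $L(X)$, $U(X)$ the sets of lower/upper bounds, $\operatorname{Max}X,\operatorname{Min}X$ the maximal/minimal elements. MLUB-complete: for every nonempty $M$, every upper bound of $M$ lies above a minimal upper bound and every lower bound below a maximal lower bound. $\mathcal P_+(X)$ = nonempty subsets. A time frame is $(T,R)$, $T\ne\emptyset$, $R\subseteq T^2$; serial: each $s$ has $r,t$ with $rRs$, $sRt$. The induced tense operators $P,F,H,G:\mathcal P_+(A^T)\to(\mathcal P_+A)^T$ are $P(C)(s)=\operatorname{Min}U(\{q(t)\mid q\in C,tRs\})$, $F(C)(s)=\operatorname{Min}U(\{q(t)\mid q\in C,sRt\})$, $H(C)(s)=\operatorname{Max}L(\{q(t)\mid q\in C,tRs\})$, $G(C)(s)=\operatorname{Max}L(\{q(t)\mid q\in C,sRt\})$. The transformation function is $\varphi:(\mathcal P_+A)^T\to\mathcal P_+(A^T)$, $\varphi(B)=\{q\in A^T\mid q(t)\in B(t)\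 \forall t\in T\}$. -}

module Defs where

open import Level using (Level; _⊔_)
open import Data.Product using (Σ; _×_; ∃; ∃-syntax; _,_)
open import Relation.Unary using (Pred; Satisfiable; _∈_; _⊆_)
open import Relation.Binary.Bundles using (Poset)

module PosetNotions {c ℓ₁ ℓ₂ : Level} (A : Poset c ℓ₁ ℓ₂) where
  open Poset A renaming (Carrier to X)

  U : ∀ {ℓ} → Pred X ℓ → Pred X (c ⊔ ℓ ⊔ ℓ₂)
  U M u = ∀ {x} → M x → x ≤ u

  L : ∀ {ℓ} → Pred X ℓ → Pred X (c ⊔ ℓ ⊔ ℓ₂)
  L M l = ∀ {x} → M x → l ≤ x

  Min : ∀ {ℓ} → Pred X ℓ → Pred X (c ⊔ ℓ ⊔ ℓ₁ ⊔ ℓ₂)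
  Min M m = M m × (∀ {y} → M y → y ≤ m → y ≈ m)

  Max : ∀ {ℓ} → Pred X ℓ → Pred X (c ⊔ ℓ ⊔ ℓ₁ ⊔ ℓ₂)
  Max M m = M m × (∀ {y} → M y → m ≤ y → y ≈ m)

  Bounded : Set (c ⊔ ℓ₂)
  Bounded = Σ X λ 0A → Σ X λ 1A → (∀ x → 0A ≤ x) × (∀ x → x ≤ 1A)

  MLUB-complete : (ℓ : Level) → Set (Level.suc ℓ ⊔ c ⊔ ℓ₁ ⊔ ℓ₂)
  MLUB-complete ℓ = (M : Pred X ℓ) → Satisfiable M →
      (∀ {u} → U M u → ∃[ m ] (Min (U M) m × m ≤ u))
    × (∀ {l} → L M l → ∃[ m ] (Max (L M) m × l ≤ m))

Serial : ∀ {t r} {T : Set t} → (T → T → Set r) → Set (t ⊔ r)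
Serial {T = T} R = ∀ s → (∃[ r ] R r s) × (∃[ u ] R s u)

module Tense {c ℓ₁ ℓ₂ t r : Level} (A : Poset c ℓ₁ ℓ₂)
             {T : Set t} (R : T → T → Set r) where
  open Poset A renaming (Carrier to X)
  open PosetNotions A

  past-values : ∀ {ℓ} → Pred (T → X) ℓ → T → Pred X (c ⊔ ℓ ⊔ t ⊔ r ⊔ ℓ₁)
  past-values C s a = ∃[ q ] (C q × ∃[ u ] (R u s × a ≈ q u))

  future-values : ∀ {ℓ} → Pred (T → X) ℓ → T → Pred X (c ⊔ ℓ ⊔ t ⊔ r ⊔ ℓ₁)
  future-values C s a = ∃[ q ] (C q × ∃[ u ] (R s u × a ≈ q u))

  P F H G : ∀ {ℓ} → Pred (T → X) ℓ → T → Pred X (c ⊔ ℓ ⊔ t ⊔ r ⊔ ℓ₁ ⊔ ℓ₂)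
  P C s = Min (U (past-values C s))
  F C s = Min (U (future-values C s))
  H C s = Max (L (past-values C s))
  G C s = Max (L (future-values C s))

  φ : ∀ {ℓ} → (T → Pred X ℓ) → Pred (T → X) (t ⊔ ℓ)
  φ B q = ∀ u → B u (q u)

  ⋃past : ∀ {ℓ} → (T → Pred X ℓ) → T → Pred X (t ⊔ r ⊔ ℓ)
  ⋃past B s a = ∃[ u ] (R u s × B u a)

  ⋃future : ∀ {ℓ} → (T → Pred X ℓ) → T → Pred X (t ⊔ r ⊔ ℓ)
  ⋃future B s a = ∃[ u ] (R s u × B u a)

-- The selections q ∈ φ(B) realise every element of every B(u) at u: fix q(u) and choose q(v) ∈ B(v)
-- arbitrarily for v ≠ u, which needs equality on T to be decidable (excluded middle). Hence
-- {q(u) | q ∈ φ(B), u ∈ S} and ⋃{B(u) | u ∈ S} coincide up to ≈, so they have the same upper and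
-- lower bounds, and thus the same minimal upper and maximal lower bounds.
module Submission where

open import Defs
open import Level using (Level; _⊔_)
open import Data.Product using (Σ-syntax; ∃-syntax; _×_; _,_; proj₁; proj₂)
open import Data.Empty using (⊥-elim)
open import Relation.Unary using (Pred; Satisfiable; _⊆_; _≐_)
open import Relation.Binary.Bundles using (Poset)
open import Relation.Binary.Definitions using (DecidableEquality)
open import Relation.Binary.PropositionalEquality using (_≡_; refl) renaming (sym to ≡-sym)
open import Relation.Nullary using (yes; no)
open import Axiom.ExcludedMiddle using (ExcludedMiddle)

module BoundsUpTo≈ {c ℓ₁ ℓ₂ : Level} (A : Poset c ℓ₁ ℓ₂) where
  open Poset A renaming (Carrier to X)
  open PosetNotions A

  _⊆≈_ : ∀ {m n} → Pred X m → Pred X n → Set (c ⊔ ℓ₁ ⊔ m ⊔ n)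
  M ⊆≈ N = ∀ {x} → M x → ∃[ y ] (N y × x ≈ y)

  U-antitone : ∀ {m n} {M : Pred X m} {N : Pred X n} → M ⊆≈ N → U N ⊆ U M
  U-antitone M⊆N u∈UN x∈M with M⊆N x∈M
  ... | y , y∈N , x≈y = ≤-respˡ-≈ (Eq.sym x≈y) (u∈UN y∈N)

  L-antitone : ∀ {m n} {M : Pred X m} {N : Pred X n} → M ⊆≈ N → L N ⊆ L M
  L-antitone M⊆N l∈LN x∈M with M⊆N x∈M
  ... | y , y∈N , x≈y = ≤-respʳ-≈ (Eq.sym x≈y) (l∈LN y∈N)

  Min-cong : ∀ {m n} {M : Pred X m} {N : Pred X n} → M ≐ N → Min M ≐ Min N
  Min-cong (M⊆N , N⊆M) =
      (λ (a∈M , minimal) → M⊆N a∈M , λ y∈N y≤a → minimal (N⊆M y∈N) y≤a)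
    , (λ (a∈N , minimal) → N⊆M a∈N , λ y∈M y≤a → minimal (M⊆N y∈M) y≤a)

  Max-cong : ∀ {m n} {M : Pred X m} {N : Pred X n} → M ≐ N → Max M ≐ Max N
  Max-cong (M⊆N , N⊆M) =
      (λ (a∈M , maximal) → M⊆N a∈M , λ y∈N a≤y → maximal (N⊆M y∈N) a≤y)
    , (λ (a∈N , maximal) → N⊆M a∈N , λ y∈M a≤y → maximal (M⊆N y∈M) a≤y)

  MinU-cong : ∀ {m n} {M : Pred X m} {N : Pred X n} →
              M ⊆≈ N → N ⊆≈ M → Min (U M) ≐ Min (U N)
  MinU-cong M⊆N N⊆M = Min-cong (U-antitone N⊆M , U-antitone M⊆N)

  MaxL-cong : ∀ {m n} {M : Pred X m} {N : Pred X n} →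
              M ⊆≈ N → N ⊆≈ M → Max (L M) ≐ Max (L N)
  MaxL-cong M⊆N N⊆M = Max-cong (L-antitone N⊆M , L-antitone M⊆N)

module Selections {c ℓ₁ ℓ₂ t b : Level} (A : Poset c ℓ₁ ℓ₂)
                  {T : Set t} (_≟_ : DecidableEquality T)
                  (B : T → Pred (Poset.Carrier A) b) (B-nonempty : ∀ u → Satisfiable (B u)) where
  open Poset A renaming (Carrier to X) hiding (refl)
  open PosetNotions A
  open BoundsUpTo≈ A

  φB : Pred (T → X) (t ⊔ b)
  φB q = ∀ u → B u (q u)

  φ-through : ∀ {u a} → B u a → Σ[ q ∈ (T → X) ] (φB q × q u ≡ a)
  φ-through {u} {a} a∈Bu = q , q∈φB , q-at-u
    where
    q : T → X
    q v with v ≟ u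
    ... | yes _ = a
    ... | no _ = proj₁ (B-nonempty v)

    q∈φB : φB q
    q∈φB v with v ≟ u
    ... | yes refl = a∈Bu
    ... | no _ = proj₂ (B-nonempty v)

    q-at-u : q u ≡ a
    q-at-u with u ≟ u
    ... | yes _ = refl
    ... | no u≢u = ⊥-elim (u≢u refl)

  module _ {s} (S : Pred T s) where

    values : Pred X (c ⊔ ℓ₁ ⊔ t ⊔ b ⊔ s)
    values a = ∃[ q ] (φB q × ∃[ u ] (S u × a ≈ q u))

    ⋃B : Pred X (t ⊔ b ⊔ s)
    ⋃B a = ∃[ u ] (S u × B u a)

    values⊆≈⋃B : values ⊆≈ ⋃B
    values⊆≈⋃B (q , q∈φB , u , u∈S , a≈qu) = q u , (u , u∈S , q∈φB u) , a≈qu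

    ⋃B⊆≈values : ⋃B ⊆≈ values
    ⋃B⊆≈values {a} (u , u∈S , a∈Bu) with φ-through a∈Bu
    ... | q , q∈φB , qu≡a = a , (q , q∈φB , u , u∈S , Eq.reflexive (≡-sym qu≡a)) , Eq.refl

    MinU-values : Min (U values) ≐ Min (U ⋃B)
    MinU-values = MinU-cong values⊆≈⋃B ⋃B⊆≈values

    MaxL-values : Max (L values) ≐ Max (L ⋃B)
    MaxL-values = MaxL-cong values⊆≈⋃B ⋃B⊆≈values

theorem3p10 : {ℓ : Level} → ExcludedMiddle ℓ →
    (A : Poset ℓ ℓ ℓ) → PosetNotions.Bounded A → PosetNotions.MLUB-complete A ℓ →
    {T : Set ℓ} (R : T → T → Set ℓ) → Serial R →
    (B : T → Pred (Poset.Carrier A) ℓ) → (∀ u → Satisfiable (B u)) →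
    (s : T) →
      (Tense.P A R (Tense.φ A R B) s ≐ PosetNotions.Min A (PosetNotions.U A (Tense.⋃past A R B s)))
    × (Tense.F A R (Tense.φ A R B) s ≐ PosetNotions.Min A (PosetNotions.U A (Tense.⋃future A R B s)))
    × (Tense.H A R (Tense.φ A R B) s ≐ PosetNotions.Max A (PosetNotions.L A (Tense.⋃past A R B s)))
    × (Tense.G A R (Tense.φ A R B) s ≐ PosetNotions.Max A (PosetNotions.L A (Tense.⋃future A R B s)))
theorem3p10 {ℓ} em A _ _ {T} R _ B B-nonempty s =
    MinU-values past , MinU-values future , MaxL-values past , MaxL-values future
  where
  open Selections A (λ _ _ → em) B B-nonempty
  past future : Pred T ℓ
  past u = R u s
  future u = R s u
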